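{- For $n,d,r\in\mathbb N$ with $d\ge 2$ and $r\le d-1$, there exists an $(n,d,r,1)$ Latin hypercube.
   Context: A $d$-dimensional hypercube of order $n$ is an array whose cells are indexed by $[n]^d$. An $\ell$-layer is the sub-array obtained by fixing $d-\ell$ coordinates and letting the other $\ell$ vary. For $0\le t\le d-r$, an $(n,d,r,t)$ Latin hypercube is a $d$-dimensional hypercube of order $n$ with entries from a set of $n^r$ symbols such that every $(d-t)$-layer contains each symbol exactly $n^{d-r-t}$ times. -}

module Defs where

open import Data.Nat using (ℕ; zero; suc; _^_; _∸_)
open import Data.Fin using (Fin)
open import Data.Fin.Properties using (_≟_; all?)
open import Data.Fin.Subset using (Subset; _∈_; ∣_∣)
open import Data.Fin.Subset.Properties using (_∈?_)
open import Data.List using (List; []; _∷_; map; concatMap; filter; length; allFin)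
open import Data.Vec.Functional using () renaming (_∷_ to _∷ᶠ_)
open import Data.Product using (_×_)
open import Relation.Binary.PropositionalEquality using (_≡_)
open import Relation.Nullary using (Dec; _×-dec_; _→-dec_)

Cell : ℕ → ℕ → Set
Cell n d = Fin d → Fin n

allCells : (n d : ℕ) → List (Cell n d)
allCells n zero = (λ ()) ∷ []
allCells n (suc d) = concatMap (λ i → map (λ f → i ∷ᶠ f) (allCells n d)) (allFin n)

Hypercube : ℕ → ℕ → ℕ → Set
Hypercube n d r = Cell n d → Fin (n ^ r)

-- Cell x lies in the layer obtained by fixing the coordinates in S
-- to the values prescribed by v (coordinates outside S vary freely).
InLayer : ∀ {n d} → Subset d → Cell n d → Cell n d → Set
InLayer S v x = ∀ i → i ∈ S → x i ≡ v i

inLayer? : ∀ {n d} (S : Subset d) (v x : Cell n d) → Dec (InLayer S v x)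
inLayer? S v x = all? (λ i → (i ∈? S) →-dec (x i ≟ v i))

countInLayer : ∀ {n d r} → Hypercube n d r → Subset d → Cell n d → Fin (n ^ r) → ℕ
countInLayer {n} {d} H S v s =
  length (filter (λ x → inLayer? S v x ×-dec (H x ≟ s)) (allCells n d))

-- (n,d,r,t) Latin hypercube: every (d-t)-layer (i.e. every layer obtained by
-- fixing exactly t coordinates to arbitrary values) contains each of the n^r
-- symbols exactly n^(d-r-t) times.
IsLatinHypercube : (n d r t : ℕ) → Hypercube n d r → Set
IsLatinHypercube n d r t H =
  (S : Subset d) → ∣ S ∣ ≡ t → (v : Cell n d) → (s : Fin (n ^ r)) →
  countInLayer {n} {d} {r} H S v s ≡ n ^ (d ∸ r ∸ t)

{-# OPTIONS --safe #-}

-- Write a cell as (x₀, x₁, …, x_m), m = d − 1, and give it the symbol whose n-ary digits are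
-- x₀ + x₁, …, x₀ + x_r (mod n).  In a layer fixing x₀ these digits are translates of
-- x₁, …, x_r, so every symbol occurs once for each choice of the m − r other coordinates.
-- In a layer fixing x_j with j ≥ 1, each choice of x₀ determines x₁, …, x_r from the symbol,
-- while the fixed coordinate either forces x₀ (j ≤ r) or is one of the otherwise free
-- coordinates (j > r); in both cases n^(m − r) cells remain.  The counting peels off one
-- coordinate at a time: a determined coordinate contributes a factor 1, a free one a factor n.

module Submission where

open import Defs
open import Data.Nat using (ℕ; _≤_; _∸_)
open import Data.Product using (Σ)

import Algebra.Properties.CommutativeMonoid.Sum as ∑
open import Data.Fin using (Fin; zero; suc; toℕ; combine; quotient; remainder; punchIn)
open import Data.Fin.Properties
  using (_≟_; toℕ-injective; toℕ-fromℕ<; toℕ<n; toℕ≤n; remQuot-combine; combine-remQuot; punchInᵢ≢i)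
open import Data.Fin.Subset using (Subset; ⊥; ⁅_⁆; ∣_∣; inside; outside)
open import Data.Fin.Subset.Properties using (x∈⁅x⁆; x∈⁅y⁆⇒x≡y)
open import Data.List using (List; []; _∷_; _++_; map; concat; filter; length; tabulate)
open import Data.List.Properties using (length-++; filter-++; filter-none; filter-all; filter-≐; map-tabulate)
open import Data.List.Relation.Unary.All using (universal)
open import Data.Nat using (zero; suc; _+_; _*_; _^_; z≤n; s≤s; _%_; NonZero)
open import Data.Nat.DivMod using (_mod_; %-distribˡ-+; m%n%n≡m%n; %-remove-+ˡ; m<n⇒m%n≡m)
open import Data.Nat.Divisibility using (∣-refl)
open import Data.Nat.Properties
  using (+-0-commutativeMonoid; suc-injective; +-identityʳ; +-comm; +-assoc; m+[n∸m]≡n; m∸n+n≡m; ∸-+-assoc)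
open import Data.Product using (∃; _×_; _,_; proj₁; proj₂)
import Data.Product as Product
open import Data.Product.Function.NonDependent.Propositional using (_×-⇔_)
open import Data.Unit using (tt)
open import Data.Vec using ([]; _∷_)
open import Data.Vec.Functional using (tail; replicate) renaming (_∷_ to _∷ᶠ_)
open import Function using (id; _∘_; _⇔_; mk⇔; Equivalence)
open import Function.Construct.Composition using (_⇔-∘_)
open import Function.Construct.Identity using (⇔-id)
open import Relation.Binary.PropositionalEquality
open import Relation.Nullary using (yes; no; ¬_; _×-dec_)
open import Relation.Unary using (Decidable)
open import Relation.Unary.Properties using (U?)

open ∑ +-0-commutativeMonoid using (sum; sum-syntax; sum-remove; sum-cong-≗; sum-replicate-zero)
open Equivalence using (to; from)

∑-const : ∀ n c → ∑[ i < n ] c ≡ n * c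
∑-const zero    c = refl
∑-const (suc n) c = cong (c +_) (∑-const n c)

∑-single : ∀ {n} (f : Fin n → ℕ) (c : Fin n) → (∀ i → i ≢ c → f i ≡ 0) → sum f ≡ f c
∑-single {suc n} f c others = begin
  sum f                      ≡⟨ sum-remove {i = c} f ⟩
  f c + sum (f ∘ punchIn c)  ≡⟨ cong (f c +_) (sum-cong-≗ (λ i → others _ (punchInᵢ≢i c i))) ⟩
  f c + sum (replicate n 0)  ≡⟨ cong (f c +_) (sum-replicate-zero n) ⟩
  f c + 0                    ≡⟨ +-identityʳ (f c) ⟩
  f c                        ∎
  where open ≡-Reasoning

module _ {A : Set} {P : A → Set} (P? : Decidable P) where

  length-filter-map : ∀ {B : Set} (f : B → A) xs →
    length (filter P? (map f xs)) ≡ length (filter (P? ∘ f) xs)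
  length-filter-map f []       = refl
  length-filter-map f (x ∷ xs) with P? (f x)
  ... | yes _ = cong suc (length-filter-map f xs)
  ... | no  _ = length-filter-map f xs

  length-filter-concat-tabulate : ∀ {n} (h : Fin n → List A) →
    length (filter P? (concat (tabulate h))) ≡ ∑[ i < n ] length (filter P? (h i))
  length-filter-concat-tabulate {zero}  h = refl
  length-filter-concat-tabulate {suc n} h = begin
    length (filter P? (h zero ++ hs))                     ≡⟨ cong length (filter-++ P? (h zero) hs) ⟩
    length (filter P? (h zero) ++ filter P? hs)           ≡⟨ length-++ (filter P? (h zero)) ⟩
    length (filter P? (h zero)) + length (filter P? hs)
      ≡⟨ cong (length (filter P? (h zero)) +_) (length-filter-concat-tabulate (h ∘ suc)) ⟩
    length (filter P? (h zero)) + ∑[ i < n ] length (filter P? (h (suc i))) ∎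
    where open ≡-Reasoning
          hs = concat (tabulate (h ∘ suc))

count : ∀ {n d} {P : Cell n d → Set} → Decidable P → ℕ
count {n} {d} P? = length (filter P? (allCells n d))

module _ {n d : ℕ} where

  count-cong : {P Q : Cell n d → Set} (P? : Decidable P) (Q? : Decidable Q) →
    (∀ x → P x ⇔ Q x) → count P? ≡ count Q?
  count-cong P? Q? P⇔Q = cong length (filter-≐ P? Q? (to (P⇔Q _) , from (P⇔Q _)) (allCells n d))

  count-none : {P : Cell n d → Set} (P? : Decidable P) → (∀ x → ¬ P x) → count P? ≡ 0
  count-none P? ¬P = cong length (filter-none P? (universal ¬P (allCells n d)))

count-∷ : ∀ {n d} {P : Cell n (suc d) → Set} (P? : Decidable P) →
  count P? ≡ ∑[ i < n ] count (λ y → P? (i ∷ᶠ y))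
count-∷ {n} {d} P? = begin
  length (filter P? (concat (map row (tabulate id))))  ≡⟨ cong (length ∘ filter P? ∘ concat) (map-tabulate id row) ⟩
  length (filter P? (concat (tabulate row)))           ≡⟨ length-filter-concat-tabulate P? row ⟩
  ∑[ i < n ] length (filter P? (row i))                ≡⟨ sum-cong-≗ (λ i → length-filter-map P? (i ∷ᶠ_) (allCells n d)) ⟩
  ∑[ i < n ] count (λ y → P? (i ∷ᶠ y))                 ∎
  where open ≡-Reasoning
        row : Fin n → List (Cell n (suc d))
        row i = map (i ∷ᶠ_) (allCells n d)

module _ {n d : ℕ} {P : Cell n (suc d) → Set} {Q : Cell n d → Set}
         (P? : Decidable P) (Q? : Decidable Q) where

  count-headDetermined : (c : Fin n) → (∀ i y → P (i ∷ᶠ y) ⇔ (i ≡ c × Q y)) → count P? ≡ count Q?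
  count-headDetermined c P⇔ = begin
    count P?                              ≡⟨ count-∷ P? ⟩
    ∑[ i < n ] count (λ y → P? (i ∷ᶠ y))  ≡⟨ ∑-single _ c (λ i i≢c → count-none _ (λ y → i≢c ∘ proj₁ ∘ to (P⇔ i y))) ⟩
    count (λ y → P? (c ∷ᶠ y))             ≡⟨ count-cong _ Q? (λ y → mk⇔ (proj₂ ∘ to (P⇔ c y)) (from (P⇔ c y) ∘ (refl ,_))) ⟩
    count Q?                              ∎
    where open ≡-Reasoning

  count-headFree : (∀ i y → P (i ∷ᶠ y) ⇔ Q y) → count P? ≡ n * count Q?
  count-headFree P⇔ = begin
    count P?                              ≡⟨ count-∷ P? ⟩
    ∑[ i < n ] count (λ y → P? (i ∷ᶠ y))  ≡⟨ sum-cong-≗ (λ i → count-cong _ Q? (P⇔ i)) ⟩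
    ∑[ i < n ] count Q?                   ≡⟨ ∑-const n (count Q?) ⟩
    n * count Q?                          ∎
    where open ≡-Reasoning

count-secondDetermined : ∀ {n d} {P : Cell n (suc (suc d)) → Set} {Q : Cell n (suc d) → Set}
  (P? : Decidable P) (Q? : Decidable Q) (f : Fin n → Fin n) →
  (∀ a k y → P (a ∷ᶠ k ∷ᶠ y) ⇔ (k ≡ f a × Q (a ∷ᶠ y))) → count P? ≡ count Q?
count-secondDetermined {n} P? Q? f P⇔ = begin
  count P?                              ≡⟨ count-∷ P? ⟩
  ∑[ a < n ] count (λ z → P? (a ∷ᶠ z))  ≡⟨ sum-cong-≗ (λ a → count-headDetermined _ (Q? ∘ (a ∷ᶠ_)) (f a) (P⇔ a)) ⟩
  ∑[ a < n ] count (λ y → Q? (a ∷ᶠ y))  ≡⟨ count-∷ Q? ⟨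
  count Q?                              ∎
  where open ≡-Reasoning

count-all : ∀ {n} d {P : Cell n d → Set} (P? : Decidable P) → (∀ x → P x) → count P? ≡ n ^ d
count-all zero P? all = cong length (filter-all P? (universal all _))
count-all {n} (suc d) P? all = begin
  count P?                       ≡⟨ count-headFree P? (U? {A = Cell n d}) (λ i y → mk⇔ _ (λ _ → all _)) ⟩
  n * count (U? {A = Cell n d})  ≡⟨ cong (n *_) (count-all d U? _) ⟩
  n * n ^ d                      ∎
  where open ≡-Reasoning

count-coordinate : ∀ {n m} (j : Fin (suc m)) (b : Fin n) →
  count (λ (x : Cell n (suc m)) → x j ≟ b) ≡ n ^ m
count-coordinate {m = m} zero b = trans
  (count-headDetermined _ (U? {A = Cell _ m}) b (λ i y → mk⇔ (_, tt) proj₁))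
  (count-all m U? _)
count-coordinate {n} {suc m} (suc j) b = trans
  (count-headFree _ (λ y → y j ≟ b) (λ i y → ⇔-id _))
  (cong (n *_) (count-coordinate j b))

infixl 6 _⊕_ _⊖_

_⊕_ : ∀ {n} → Fin n → Fin n → Fin n
_⊕_ {suc n} a b = (toℕ a + toℕ b) mod suc n

_⊖_ : ∀ {n} → Fin n → Fin n → Fin n
_⊖_ {suc n} s a = (suc n ∸ toℕ a + toℕ s) mod suc n

[m+n%d]%d≡[m+n]%d : ∀ m n d .{{_ : NonZero d}} → (m + n % d) % d ≡ (m + n) % d
[m+n%d]%d≡[m+n]%d m n d = begin
  (m + n % d) % d          ≡⟨ %-distribˡ-+ m (n % d) d ⟩
  (m % d + n % d % d) % d  ≡⟨ cong (λ k → (m % d + k) % d) (m%n%n≡m%n n d) ⟩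
  (m % d + n % d) % d      ≡⟨ %-distribˡ-+ m n d ⟨
  (m + n) % d              ∎
  where open ≡-Reasoning

module _ {k : ℕ} where
  private
    n = suc k

  [n+a]%n≡a : (a : Fin n) → (n + toℕ a) % n ≡ toℕ a
  [n+a]%n≡a a = trans (%-remove-+ˡ (toℕ a) (∣-refl {n})) (m<n⇒m%n≡m (toℕ<n a))

  ⊕-comm : (a b : Fin n) → a ⊕ b ≡ b ⊕ a
  ⊕-comm a b = cong (_mod n) (+-comm (toℕ a) (toℕ b))

  ⊕-⊖-cancel : (a s : Fin n) → a ⊕ (s ⊖ a) ≡ s
  ⊕-⊖-cancel a s = toℕ-injective (begin
    toℕ (a ⊕ (s ⊖ a))                      ≡⟨ toℕ-fromℕ< _ ⟩
    (toℕ a + toℕ (s ⊖ a)) % n              ≡⟨ cong (λ t → (toℕ a + t) % n) (toℕ-fromℕ< _) ⟩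
    (toℕ a + (n ∸ toℕ a + toℕ s) % n) % n  ≡⟨ [m+n%d]%d≡[m+n]%d (toℕ a) _ n ⟩
    (toℕ a + (n ∸ toℕ a + toℕ s)) % n      ≡⟨ cong (_% n) (+-assoc (toℕ a) _ _) ⟨
    (toℕ a + (n ∸ toℕ a) + toℕ s) % n      ≡⟨ cong (λ t → (t + toℕ s) % n) (m+[n∸m]≡n (toℕ≤n a)) ⟩
    (n + toℕ s) % n                        ≡⟨ [n+a]%n≡a s ⟩
    toℕ s                                  ∎)
    where open ≡-Reasoning

  ⊖-⊕-cancel : (a b : Fin n) → (a ⊕ b) ⊖ a ≡ b
  ⊖-⊕-cancel a b = toℕ-injective (begin
    toℕ ((a ⊕ b) ⊖ a)                      ≡⟨ toℕ-fromℕ< _ ⟩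
    (n ∸ toℕ a + toℕ (a ⊕ b)) % n          ≡⟨ cong (λ t → (n ∸ toℕ a + t) % n) (toℕ-fromℕ< _) ⟩
    (n ∸ toℕ a + (toℕ a + toℕ b) % n) % n  ≡⟨ [m+n%d]%d≡[m+n]%d (n ∸ toℕ a) _ n ⟩
    (n ∸ toℕ a + (toℕ a + toℕ b)) % n      ≡⟨ cong (_% n) (+-assoc (n ∸ toℕ a) _ _) ⟨
    (n ∸ toℕ a + toℕ a + toℕ b) % n        ≡⟨ cong (λ t → (t + toℕ b) % n) (m∸n+n≡m (toℕ≤n a)) ⟩
    (n + toℕ b) % n                        ≡⟨ [n+a]%n≡a b ⟩
    toℕ b                                  ∎)
    where open ≡-Reasoning

a⊕b≡s⇔b≡s⊖a : ∀ {n} {a b s : Fin n} → a ⊕ b ≡ s ⇔ b ≡ s ⊖ a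
a⊕b≡s⇔b≡s⊖a {suc _} {a} {b} = mk⇔
  (λ { refl → sym (⊖-⊕-cancel a b) })
  (λ { refl → ⊕-⊖-cancel a _ })

a⊕b≡s⇔a≡s⊖b : ∀ {n} {a b s : Fin n} → a ⊕ b ≡ s ⇔ a ≡ s ⊖ b
a⊕b≡s⇔a≡s⊖b {suc _} {a} {b} = a⊕b≡s⇔b≡s⊖a {a = b} ⇔-∘ mk⇔ (trans (⊕-comm b a)) (trans (⊕-comm a b))

≡×⇔≡×-subst : ∀ {A : Set} {B : A → Set} {i c : A} → (i ≡ c × B i) ⇔ (i ≡ c × B c)
≡×⇔≡×-subst = mk⇔ (λ { (refl , b) → refl , b }) (λ { (refl , b) → refl , b })

combine≡⇔≡remQuot : ∀ {m k} {i : Fin m} {j : Fin k} {s : Fin (m * k)} →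
  combine i j ≡ s ⇔ (i ≡ quotient {m} k s × j ≡ remainder {m} k s)
combine≡⇔≡remQuot {m} {k} {i} {j} {s} = mk⇔
  (λ { refl → sym (cong proj₁ (remQuot-combine i j)) , sym (cong proj₂ (remQuot-combine i j)) })
  (λ { (refl , refl) → combine-remQuot {m} k s })

shiftCode : ∀ {n r m} → r ≤ m → Fin n → Cell n m → Fin (n ^ r)
shiftCode z≤n     a y = zero
shiftCode (s≤s p) a y = combine (a ⊕ y zero) (shiftCode p a (tail y))

latinCube : ∀ {n r m} → r ≤ m → Hypercube n (suc m) r
latinCube p x = shiftCode p (x zero) (tail x)

shiftCode-fibre : ∀ {n r m} (p : r ≤ m) (a : Fin n) (s : Fin (n ^ r)) →
  count (λ y → shiftCode p a y ≟ s) ≡ n ^ (m ∸ r)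
shiftCode-fibre {m = m} z≤n a zero = count-all m _ (λ _ → refl)
shiftCode-fibre {n} {suc r} (s≤s p) a s = trans
  (count-headDetermined _ (λ y → shiftCode p a y ≟ remainder {n} (n ^ r) s) (quotient (n ^ r) s ⊖ a)
    (λ k y → (a⊕b≡s⇔b≡s⊖a ×-⇔ ⇔-id _) ⇔-∘ combine≡⇔≡remQuot))
  (shiftCode-fibre p a _)

latinCube-pivotLayer : ∀ {n r m} (p : r ≤ m) (b : Fin n) (s : Fin (n ^ r)) →
  count (λ x → (x zero ≟ b) ×-dec (latinCube p x ≟ s)) ≡ n ^ (m ∸ r)
latinCube-pivotLayer p b s = trans
  (count-headDetermined _ (λ y → shiftCode p b y ≟ s) b (λ a y → ≡×⇔≡×-subst))
  (shiftCode-fibre p b s)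

latinCube-offPivotLayer : ∀ {n r m} (p : r ≤ m) (j : Fin m) (b : Fin n) (s : Fin (n ^ r)) →
  count (λ x → (x (suc j) ≟ b) ×-dec (latinCube p x ≟ s)) ≡ n ^ (m ∸ r)
latinCube-offPivotLayer z≤n j b zero = trans
  (count-cong _ (λ x → x (suc j) ≟ b) (λ x → mk⇔ proj₁ (_, refl)))
  (count-coordinate (suc j) b)
latinCube-offPivotLayer {n} {suc r} (s≤s p) zero b s = begin
  count (λ x → (x (suc zero) ≟ b) ×-dec (latinCube (s≤s p) x ≟ s))
    ≡⟨ count-secondDetermined _ (λ x → combine (x zero ⊕ b) (latinCube p x) ≟ s) (λ _ → b)
         (λ a k y → ≡×⇔≡×-subst) ⟩
  count (λ x → combine (x zero ⊕ b) (latinCube p x) ≟ s)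
    ≡⟨ count-headDetermined _ (λ y → shiftCode p (q ⊖ b) y ≟ ρ) (q ⊖ b)
         (λ a y → ≡×⇔≡×-subst ⇔-∘ ((a⊕b≡s⇔a≡s⊖b ×-⇔ ⇔-id _) ⇔-∘ combine≡⇔≡remQuot)) ⟩
  count (λ y → shiftCode p (q ⊖ b) y ≟ ρ)
    ≡⟨ shiftCode-fibre p (q ⊖ b) ρ ⟩
  n ^ (_ ∸ r) ∎
  where open ≡-Reasoning
        q = quotient (n ^ r) s
        ρ = remainder {n} (n ^ r) s
latinCube-offPivotLayer {n} {suc r} (s≤s p) (suc j) b s = trans
  (count-secondDetermined _ (λ x → (x (suc j) ≟ b) ×-dec (latinCube p x ≟ ρ)) (λ a → q ⊖ a)
    (λ a k y → mk⇔
      (λ (yj≡b , c) → let (e₁ , e₂) = to combine≡⇔≡remQuot c in to a⊕b≡s⇔b≡s⊖a e₁ , yj≡b , e₂)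
      (λ (k≡q⊖a , yj≡b , e₂) → yj≡b , from combine≡⇔≡remQuot (from a⊕b≡s⇔b≡s⊖a k≡q⊖a , e₂))))
  (latinCube-offPivotLayer p j b ρ)
  where q = quotient (n ^ r) s
        ρ = remainder {n} (n ^ r) s

latinCube-layer : ∀ {n r m} (p : r ≤ m) (j : Fin (suc m)) (b : Fin n) (s : Fin (n ^ r)) →
  count (λ x → (x j ≟ b) ×-dec (latinCube p x ≟ s)) ≡ n ^ (m ∸ r)
latinCube-layer p zero    = latinCube-pivotLayer p
latinCube-layer p (suc j) = latinCube-offPivotLayer p j

∣p∣≡0⇒p≡⊥ : ∀ {d} (p : Subset d) → ∣ p ∣ ≡ 0 → p ≡ ⊥
∣p∣≡0⇒p≡⊥ []            _  = refl
∣p∣≡0⇒p≡⊥ (outside ∷ p) eq = cong (outside ∷_) (∣p∣≡0⇒p≡⊥ p eq)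

∣p∣≡1⇒p≡⁅i⁆ : ∀ {d} (p : Subset d) → ∣ p ∣ ≡ 1 → ∃ λ i → p ≡ ⁅ i ⁆
∣p∣≡1⇒p≡⁅i⁆ (inside ∷ p)  eq = zero , cong (inside ∷_) (∣p∣≡0⇒p≡⊥ p (suc-injective eq))
∣p∣≡1⇒p≡⁅i⁆ (outside ∷ p) eq = Product.map suc (cong (outside ∷_)) (∣p∣≡1⇒p≡⁅i⁆ p eq)

InLayer⁅j⁆⇔ : ∀ {n d} {j : Fin d} {v x : Cell n d} → InLayer ⁅ j ⁆ v x ⇔ x j ≡ v j
InLayer⁅j⁆⇔ {j = j} {v} {x} = mk⇔
  (λ fixed → fixed j (x∈⁅x⁆ j))
  (λ { eq i i∈⁅j⁆ → subst (λ k → x k ≡ v k) (sym (x∈⁅y⁆⇒x≡y j i∈⁅j⁆)) eq })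

latinCube-isLatin : ∀ {n r m} (p : r ≤ m) → IsLatinHypercube n (suc m) r 1 (latinCube p)
latinCube-isLatin {n} {r} {m} p S ∣S∣≡1 v s with ∣p∣≡1⇒p≡⁅i⁆ S ∣S∣≡1
... | j , refl = begin
  count (λ x → inLayer? ⁅ j ⁆ v x ×-dec (latinCube p x ≟ s))
    ≡⟨ count-cong {n} {suc m} _ _ (λ x → InLayer⁅j⁆⇔ ×-⇔ ⇔-id _) ⟩
  count (λ x → (x j ≟ v j) ×-dec (latinCube p x ≟ s))  ≡⟨ latinCube-layer p j (v j) s ⟩
  n ^ (suc m ∸ suc r)                                   ≡⟨ cong (λ k → n ^ (suc m ∸ k)) (+-comm r 1) ⟨
  n ^ (suc m ∸ (r + 1))                                 ≡⟨ cong (n ^_) (∸-+-assoc (suc m) r 1) ⟨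
  n ^ (suc m ∸ r ∸ 1)                                   ∎
  where open ≡-Reasoning

theorem5p1 : (n d r : ℕ) → 2 ≤ d → r ≤ d ∸ 1 →
    Σ (Hypercube n d r) (IsLatinHypercube n d r 1)
theorem5p1 n zero    r ()  _
theorem5p1 n (suc m) r _   r≤m = latinCube r≤m , latinCube-isLatin r≤m
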